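{- Let $S$ be a solid and let $x,y\in S$ with $x\ne e(x)$ and $y\ne e(y)$. If $R(x)\le R(y)$, then $e(x)y\le e(y)x$.
   Context: A solid is a set $S$ with binary operations $+$ and $\cdot$ and a relation $\le$ satisfying: (1) $+$ is associative and commutative; for every $x$ there is a unique $e$ with $x+e=x$ and $e+f=e$ whenever $x+f=x$, written $e(x)$ (the magnitude of $x$); for every $x$ there is $s$ with $x+s=e(x)$ and $e(s)=e(x)$, written $-x$; $e(x+y)=e(x)$ or $e(x+y)=e(y)$. (2) $\cdot$ is associative and commutative; for every $x\ne e(x)$ there is a unique $u$ with $xu=x$ and $uv=u$ whenever $xv=x$, written $u(x)$; for every $x\ne e(x)$ there is $d$ with $xd=u(x)$ and $u(d)=u(x)$, written $x^{ -1}$; for $x\ne e(x),y\ne e(y)$: $u(xy)=u(x)$ or $u(xy)=u(y)$. (3) $\le$ is a total order; $x\le y\Rightarrow x+z\le y+z$; $y+e(x)=e(x)\Rightarrow (y\le e(x)$ and $-y\le e(x))$; $(e(x)<x$ and $y\le z)\Rightarrow xy\le xz$; $e(y)\le y\le z\Rightarrow e(x)y\le e(x)z$. (4) For all $x,y$ there is $z$ with $e(x)y=e(z)$; $e(xy)=e(x)y+e(y)x$; for $x\ne e(x)$, $e(u(x))=e(x)x^{ -1}$; $xy+xz=x(y+z)+e(x)y+e(x)z$; $-(xy)=(-x)y$. (5) There is $0$ with $0+x=x$ for all $x$; there is $1$ with $1x=x$ for all $x$; there is $M$ with $e(x)+M=M$ for all $x$; there is $x$ with $e(x)\ne 0$ and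 $e(x)\ne M$; for every $x$ there is $a$ with $x=a+e(x)$ and $e(a)=0$; if $x=e(x)$, $y=e(y)$ and $x<y$ then there is $z\ne e(z)$ with $x<z<y$. For $x\ne e(x)$ the relative uncertainty is $R(x)=e(u(x))$. -}

module Defs where

open import Level using (Level; suc; _⊔_)
open import Relation.Binary.PropositionalEquality using (_≡_; _≢_)
open import Relation.Binary.Structures using (IsTotalOrder)
open import Data.Product using (Σ; ∃; _×_)
open import Data.Sum using (_⊎_)

-- The operations e (magnitude), -_,
-- u (neutral element of multiplication) and _⁻¹ are given as functions
-- together with their characterizing properties (including uniqueness
-- for e and u). u and _⁻¹ are total functions, but their axioms only
-- constrain them on elements x with x ≢ e x, exactly as in the paper.
record Solid (a ℓ : Level) : Set (suc (a ⊔ ℓ)) where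
  infixl 6 _+_
  infixl 7 _·_
  infix 4 _≤_ _<_
  field
    S    : Set a
    _+_  : S → S → S
    _·_  : S → S → S
    _≤_  : S → S → Set ℓ
    e    : S → S
    -_   : S → S
    u    : S → S
    _⁻¹  : S → S
    𝟘 𝟙 M : S

  _<_ : S → S → Set (a ⊔ ℓ)
  x < y = (x ≤ y) × (x ≢ y)

  field
    +-assoc : ∀ x y z → (x + y) + z ≡ x + (y + z)
    +-comm  : ∀ x y → x + y ≡ y + x
    e-neutral : ∀ x → x + e x ≡ x
    e-min     : ∀ x f → x + f ≡ x → e x + f ≡ e x
    e-unique  : ∀ x e′ → x + e′ ≡ x → (∀ f → x + f ≡ x → e′ + f ≡ e′) → e′ ≡ e x
    neg-inv   : ∀ x → x + (- x) ≡ e x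
    neg-e     : ∀ x → e (- x) ≡ e x
    e-+       : ∀ x y → (e (x + y) ≡ e x) ⊎ (e (x + y) ≡ e y)
    ·-assoc : ∀ x y z → (x · y) · z ≡ x · (y · z)
    ·-comm  : ∀ x y → x · y ≡ y · x
    u-neutral : ∀ x → x ≢ e x → x · u x ≡ x
    u-min     : ∀ x → x ≢ e x → ∀ v → x · v ≡ x → u x · v ≡ u x
    u-unique  : ∀ x → x ≢ e x → ∀ u′ → x · u′ ≡ x
                  → (∀ v → x · v ≡ x → u′ · v ≡ u′) → u′ ≡ u x
    inv-inv   : ∀ x → x ≢ e x → x · (x ⁻¹) ≡ u x
    inv-u     : ∀ x → x ≢ e x → u (x ⁻¹) ≡ u x
    u-·       : ∀ x y → x ≢ e x → y ≢ e y
                  → (u (x · y) ≡ u x) ⊎ (u (x · y) ≡ u y)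
    ≤-isTotalOrder : IsTotalOrder _≡_ _≤_
    ≤-+    : ∀ x y z → x ≤ y → x + z ≤ y + z
    ≤-e    : ∀ x y → y + e x ≡ e x → (y ≤ e x) × (- y ≤ e x)
    ≤-·    : ∀ x y z → e x < x → y ≤ z → x · y ≤ x · z
    ≤-e·   : ∀ x y z → e y ≤ y → y ≤ z → e x · y ≤ e x · z
    e·-e      : ∀ x y → ∃ λ z → e x · y ≡ e z
    e-·       : ∀ x y → e (x · y) ≡ e x · y + e y · x
    e-u       : ∀ x → x ≢ e x → e (u x) ≡ e x · (x ⁻¹)
    distrib   : ∀ x y z → x · y + x · z ≡ x · (y + z) + e x · y + e x · z
    neg-·     : ∀ x y → - (x · y) ≡ (- x) · y
    𝟘-identity : ∀ x → 𝟘 + x ≡ x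
    𝟙-identity : ∀ x → 𝟙 · x ≡ x
    M-max      : ∀ x → e x + M ≡ M
    nontrivial : ∃ λ x → (e x ≢ 𝟘) × (e x ≢ M)
    decompose  : ∀ x → ∃ λ a → (x ≡ a + e x) × (e a ≡ 𝟘)
    dense      : ∀ x y → x ≡ e x → y ≡ e y → x < y
                   → ∃ λ z → (z ≢ e z) × (x < z) × (z < y)

  -- relative uncertainty (meaningful for x ≢ e x)
  R : S → S
  R x = e (u x)

-- Write R x = e x · x⁻¹ and let x′, y′ be the positive one of ±x and ±y (that is,
-- e x′ < x′).  Multiplying R x ≤ R y by the positive elements x′ and y′ preserves
-- the order, and e x · x⁻¹ · x′ · y′ = e x · y because a magnitude factor absorbs
-- signs (e z · (- t) = e z · t) and e x · u x = e x; symmetrically for the right side.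
module Submission where

open import Defs
open import Level using (Level)
open import Algebra.Bundles using (CommutativeSemigroup)
open import Data.Product using (∃; _×_; _,_)
open import Data.Sum using (_⊎_; inj₁; inj₂)
open import Relation.Binary.PropositionalEquality
  using (_≡_; _≢_; refl; sym; trans; cong; cong₂; subst₂; isEquivalence; module ≡-Reasoning)
open import Relation.Binary.Structures using (IsTotalOrder)

module SolidProperties {a ℓ : Level} (𝕊 : Solid a ℓ) where
  open Solid 𝕊
  open ≡-Reasoning

  ·-commutativeSemigroup : CommutativeSemigroup a a
  ·-commutativeSemigroup = record
    { Carrier = S
    ; _≈_ = _≡_
    ; _∙_ = _·_
    ; isCommutativeSemigroup = record
      { isSemigroup = record
        { isMagma = record { isEquivalence = isEquivalence ; ∙-cong = cong₂ _·_ }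
        ; assoc = ·-assoc
        }
      ; comm = ·-comm
      }
    }

  open import Algebra.Properties.CommutativeSemigroup ·-commutativeSemigroup
    using (xy∙z≈xz∙y; x∙yz≈z∙yx)

  infix 4 _±≡_
  _±≡_ : S → S → Set a
  s ±≡ t = s ≡ t ⊎ s ≡ - t

  e-idem : ∀ x → e x + e x ≡ e x
  e-idem x = e-min x (e x) (e-neutral x)

  e-e : ∀ x → e (e x) ≡ e x
  e-e x = sym (e-unique (e x) (e x) (e-idem x) (λ _ p → p))

  -‿e : ∀ x → - e x ≡ e x
  -‿e x = begin
    - e x               ≡⟨ sym (e-neutral (- e x)) ⟩
    - e x + e (- e x)   ≡⟨ cong (- e x +_) (trans (neg-e (e x)) (e-e x)) ⟩
    - e x + e x         ≡⟨ +-comm (- e x) (e x) ⟩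
    e x + - e x         ≡⟨ neg-inv (e x) ⟩
    e (e x)             ≡⟨ e-e x ⟩
    e x                 ∎

  -- e z · t is itself a magnitude (axiom e·-e), hence fixed by negation.
  e·-‿ : ∀ z t → e z · (- t) ≡ e z · t
  e·-‿ z t with e·-e z t
  ... | w , e·t≡ew = begin
    e z · (- t)   ≡⟨ ·-comm (e z) (- t) ⟩
    (- t) · e z   ≡⟨ sym (neg-· t (e z)) ⟩
    - (t · e z)   ≡⟨ cong -_ (trans (·-comm t (e z)) e·t≡ew) ⟩
    - e w         ≡⟨ -‿e w ⟩
    e w           ≡⟨ sym e·t≡ew ⟩
    e z · t       ∎

  e·-±≡ : ∀ z r {s t} → s ±≡ t → e z · (r · s) ≡ e z · (r · t)
  e·-±≡ z r (inj₁ refl) = refl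
  e·-±≡ z r {t = t} (inj₂ refl) = begin
    e z · (r · (- t))   ≡⟨ cong (e z ·_) (trans (·-comm r (- t)) (sym (neg-· t r))) ⟩
    e z · (- (t · r))   ≡⟨ e·-‿ z (t · r) ⟩
    e z · (t · r)       ≡⟨ cong (e z ·_) (·-comm t r) ⟩
    e z · (r · t)       ∎

  -- Both summands of e (x · u x) = e x · u x + e (u x) · x equal the magnitude e x · u x.
  e·u : ∀ {x} → x ≢ e x → e x · u x ≡ e x
  e·u {x} x≢ex with e·-e x (u x)
  ... | w , e·u≡ew = sym (begin
    e x                             ≡⟨ cong e (sym (u-neutral x x≢ex)) ⟩
    e (x · u x)                     ≡⟨ e-· x (u x) ⟩
    e x · u x + e (u x) · x         ≡⟨ cong (λ r → e x · u x + r · x) (e-u x x≢ex) ⟩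
    e x · u x + (e x · x ⁻¹) · x    ≡⟨ cong (e x · u x +_) R·x≡e·u ⟩
    e x · u x + e x · u x           ≡⟨ cong₂ _+_ e·u≡ew e·u≡ew ⟩
    e w + e w                       ≡⟨ e-idem w ⟩
    e w                             ≡⟨ sym e·u≡ew ⟩
    e x · u x                       ∎)
    where
    R·x≡e·u : (e x · x ⁻¹) · x ≡ e x · u x
    R·x≡e·u = trans (·-assoc (e x) (x ⁻¹) x)
                (cong (e x ·_) (trans (·-comm (x ⁻¹) x) (inv-inv x x≢ex)))

  R-scale : ∀ {p q p′ q′} → p ≢ e p → p′ ±≡ p → q′ ±≡ q
          → (e p · p ⁻¹) · (p′ · q′) ≡ e p · q
  R-scale {p} {q} {p′} {q′} p≢ep p′±p q′±q = begin
    (e p · i) · (p′ · q′)   ≡⟨ ·-assoc (e p) i (p′ · q′) ⟩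
    e p · (i · (p′ · q′))   ≡⟨ cong (e p ·_) (sym (·-assoc i p′ q′)) ⟩
    e p · ((i · p′) · q′)   ≡⟨ e·-±≡ p (i · p′) q′±q ⟩
    e p · ((i · p′) · q)    ≡⟨ cong (e p ·_) (xy∙z≈xz∙y i p′ q) ⟩
    e p · ((i · q) · p′)    ≡⟨ e·-±≡ p (i · q) p′±p ⟩
    e p · ((i · q) · p)     ≡⟨ cong (e p ·_) (xy∙z≈xz∙y i q p) ⟩
    e p · ((i · p) · q)     ≡⟨ cong (λ r → e p · (r · q)) (trans (·-comm i p) (inv-inv p p≢ep)) ⟩
    e p · (u p · q)         ≡⟨ sym (·-assoc (e p) (u p) q) ⟩
    (e p · u p) · q         ≡⟨ cong (_· q) (e·u p≢ep) ⟩
    e p · q                 ∎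
    where
    i = p ⁻¹

  e≤- : ∀ {x} → x ≤ e x → e x ≤ - x
  e≤- {x} x≤ex = subst₂ _≤_ (neg-inv x) ex+-x≡-x (≤-+ x (e x) (- x) x≤ex)
    where
    ex+-x≡-x : e x + - x ≡ - x
    ex+-x≡-x = trans (+-comm (e x) (- x))
                 (trans (cong (- x +_) (sym (neg-e x))) (e-neutral (- x)))

  e≢- : ∀ {x} → x ≢ e x → e x ≢ - x
  e≢- {x} x≢ex ex≡-x = x≢ex (begin
    x          ≡⟨ sym (e-neutral x) ⟩
    x + e x    ≡⟨ cong (x +_) ex≡-x ⟩
    x + - x    ≡⟨ neg-inv x ⟩
    e x        ∎)

  positive-±≡ : ∀ {x} → x ≢ e x → ∃ λ s → s ±≡ x × e s < s
  positive-±≡ {x} x≢ex with IsTotalOrder.total ≤-isTotalOrder (e x) x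
  ... | inj₁ ex≤x = x , inj₁ refl , ex≤x , (λ ex≡x → x≢ex (sym ex≡x))
  ... | inj₂ x≤ex = - x , inj₂ refl
      , subst₂ _≤_ (sym (neg-e x)) refl (e≤- x≤ex)
      , (λ e-x≡-x → e≢- x≢ex (trans (sym (neg-e x)) e-x≡-x))

  ≤-·-positive : ∀ {a b c d} → e a < a → e b < b → c ≤ d → c · (a · b) ≤ d · (a · b)
  ≤-·-positive {a} {b} {c} {d} a>0 b>0 c≤d =
    subst₂ _≤_ (x∙yz≈z∙yx b a c) (x∙yz≈z∙yx b a d) (≤-· b _ _ b>0 (≤-· a c d a>0 c≤d))

lemma4p8 : ∀ {a ℓ : Level} (𝕊 : Solid a ℓ) → let open Solid 𝕊 in
    ∀ (x y : S) → x ≢ e x → y ≢ e y → R x ≤ R y → e x · y ≤ e y · x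
lemma4p8 𝕊 x y x≢ex y≢ey Rx≤Ry
  with SolidProperties.positive-±≡ 𝕊 x≢ex | SolidProperties.positive-±≡ 𝕊 y≢ey
... | x′ , x′±x , x′>0 | y′ , y′±y , y′>0 =
  subst₂ _≤_ (R-scale x≢ex x′±x y′±y) Ry·x′y′≡ey·x
    (≤-·-positive x′>0 y′>0 (subst₂ _≤_ (e-u x x≢ex) (e-u y y≢ey) Rx≤Ry))
  where
  open Solid 𝕊
  open SolidProperties 𝕊
  Ry·x′y′≡ey·x : (e y · y ⁻¹) · (x′ · y′) ≡ e y · x
  Ry·x′y′≡ey·x = trans (cong (e y · y ⁻¹ ·_) (·-comm x′ y′)) (R-scale y≢ey y′±y x′±x)
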